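{- If $U$ is a $p$-point ultrafilter on $\omega$, then $U\cdot U\le_T U\times\prod_{n<\omega}\mathrm{fin}$.
   Context: $\mathrm{fin}=[\omega]^{<\omega}$, ordered by $\subseteq$. A $p$-point is a nonprincipal ultrafilter $U$ on $\omega$ such that for every sequence $\langle A_n\rangle\subseteq U$ there is $A\in U$ with $A\setminus A_n$ finite for all $n$. $U\cdot U$ is the filter on $\omega\times\omega$ with $A\in U\cdot U$ iff $\{x:\{y:(x,y)\in A\}\in U\}\in U$. Ultrafilters are ordered by $\supseteq$; products coordinatewise. $P\le_TQ$ means there is $f:Q\to P$ mapping cofinal subsets of $Q$ to cofinal subsets of $P$. -}

module Defs where

open import Level using (Level; _⊔_) renaming (suc to lsuc; zero to 0ℓ)
open import Data.Nat using (ℕ; _<_; _≥_)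
open import Data.Product using (Σ; ∃; _×_; _,_; proj₁; proj₂)
open import Data.Sum using (_⊎_)
open import Data.Empty using (⊥)
open import Data.List using (List)
open import Data.List.Membership.Propositional using (_∈_)
open import Relation.Nullary using (¬_)
open import Relation.Binary.PropositionalEquality using (_≡_)

Subset : Set → Set₁
Subset X = X → Set

_⊆_ : {X : Set} → Subset X → Subset X → Set
A ⊆ B = ∀ x → A x → B x

_∩_ : {X : Set} → Subset X → Subset X → Subset X
(A ∩ B) x = A x × B x

∁ : {X : Set} → Subset X → Subset X
∁ A x = ¬ A x

∅ : {X : Set} → Subset X
∅ _ = ⊥

Whole : {X : Set} → Subset X
Whole _ = Data.Unit.⊤
  where import Data.Unit

Family : Set → Set₁
Family X = Subset X → Set

record IsUltrafilter {X : Set} (U : Family X) : Set₁ where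
  field
    whole    : U Whole
    proper   : ¬ U ∅
    upward   : ∀ {A B} → U A → A ⊆ B → U B
    meet     : ∀ {A B} → U A → U B → U (A ∩ B)
    ultra    : ∀ A → U A ⊎ U (∁ A)

record IsNonprincipalUltrafilter (U : Family ℕ) : Set₁ where
  field
    isUltrafilter : IsUltrafilter U
    nonprincipal  : ∀ n → ¬ U (λ k → k ≡ n)

Finite : Subset ℕ → Set
Finite A = ∃ λ N → ∀ k → A k → k < N

_∖_ : {X : Set} → Subset X → Subset X → Subset X
(A ∖ B) x = A x × ¬ B x

record IsPPoint (U : Family ℕ) : Set₁ where
  field
    nonprincipalUltrafilter : IsNonprincipalUltrafilter U
    pseudoIntersection : (As : ℕ → Subset ℕ) → (∀ n → U (As n)) →
                         Σ (Subset ℕ) λ A → U A × (∀ n → Finite (A ∖ As n))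

_·_ : Family ℕ → Family ℕ → Family (ℕ × ℕ)
(U · V) A = U (λ x → V (λ y → A (x , y)))

Elem : {X : Set} → Family X → Set₁
Elem {X} U = Σ (Subset X) U

_≤U_ : {X : Set} {U : Family X} → Elem U → Elem U → Set
(A , _) ≤U (B , _) = B ⊆ A

-- fin = [ω]^{<ω}, finite subsets represented as lists, ordered by inclusion.
Fin' : Set
Fin' = List ℕ

_≤fin_ : Fin' → Fin' → Set
s ≤fin t = ∀ {k} → k ∈ s → k ∈ t

UProdFin : Family ℕ → Set₁
UProdFin U = Elem U × (ℕ → Fin')

_≤UPF_ : {U : Family ℕ} → UProdFin U → UProdFin U → Set
_≤UPF_ {U} (a , h) (b , g) = _≤U_ {U = U} a b × (∀ n → h n ≤fin g n)

Cofinal : {a r : Level} (P : Set a) (_≤_ : P → P → Set r) → (P → Set a) → Set (a ⊔ r)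
Cofinal P _≤_ X = ∀ p → ∃ λ x → X x × p ≤ x

Image : {a b : Level} {P : Set a} {Q : Set b} → (Q → P) → (Q → Set b) → P → Set (a ⊔ b)
Image f X p = ∃ λ q → X q × f q ≡ p

TukeyLE : {a r s : Level} (P : Set a) (_≤P_ : P → P → Set r)
          (Q : Set a) (_≤Q_ : Q → Q → Set s) → Set (lsuc a ⊔ r ⊔ s)
TukeyLE P _≤P_ Q _≤Q_ =
  Σ (Q → P) λ f → ∀ (X : Q → Set _) → Cofinal Q _≤Q_ X → Cofinal P _≤P_ (Image f X)

{-# OPTIONS --safe #-}
module Submission where

-- For A ∈ U·U, let N x bound the finite part of a pseudo-intersection C ∈ U of the
-- fibres A_x = {y : (x , y) ∈ A} that lie in U. The diagonal set
-- D = {y : y ∈ A_x whenever x < y, N x ≤ y and A_x ∈ U} contains C (up to double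
-- negation), so D ∈ U. Sending (B , h) to {(x , y) : x , y ∈ B, y ∉ h x} is then a
-- convergent map U × ∏ fin → U·U: every (B , h) above ({x ∈ D : A_x ∈ U} , x ↦ [0, (1 + x) ⊔ N x))
-- is sent into A.

open import Level using (Level) renaming (_⊔_ to _⊔ℓ_)
open import Defs
open import Data.Nat using (ℕ; zero; suc; _<_; _≤_; _⊔_; _≤?_)
open import Data.Nat.Properties using (≮⇒≥; <⇒≱; n<1+n; m<n⇒m<1+n; m<1+n⇒m<n∨m≡n; m⊔n≤o⇒m≤o; m⊔n≤o⇒n≤o)
open import Data.Product using (Σ; ∃; _×_; _,_; proj₁; proj₂)
open import Data.Sum using (inj₁; inj₂)
open import Data.Empty using (⊥-elim)
open import Data.List using ([]; _∷_; upTo)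
open import Data.List.Relation.Unary.Any using (here; there)
open import Data.List.Membership.Propositional using (_∈_)
open import Data.List.Membership.Propositional.Properties using (∈-upTo⁺)
open import Effect.Monad using (RawMonad)
open import Relation.Nullary using (¬_; yes; no)
open import Relation.Nullary.Negation using (¬¬-Monad; ¬¬-map; contradiction)
open import Relation.Binary.PropositionalEquality using (_≡_; refl)

open RawMonad (¬¬-Monad {a = Level.zero})

Convergent : {a r s : Level} {P : Set a} (_≤P_ : P → P → Set r)
             {Q : Set a} (_≤Q_ : Q → Q → Set s) → (Q → P) → Set (a ⊔ℓ r ⊔ℓ s)
Convergent _≤P_ _≤Q_ f = ∀ p → ∃ λ q → ∀ q′ → q ≤Q q′ → p ≤P f q′

convergent⇒tukey : {a r s : Level} {P : Set a} {_≤P_ : P → P → Set r}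
                   {Q : Set a} {_≤Q_ : Q → Q → Set s} (f : Q → P) →
                   Convergent _≤P_ _≤Q_ f → TukeyLE P _≤P_ Q _≤Q_
convergent⇒tukey f conv = f , λ X cofinal p →
  let (q , above-q↦above-p) = conv p
      (q′ , q′∈X , q≤q′) = cofinal q
  in f q′ , (q′ , q′∈X , refl) , above-q↦above-p q′ q≤q′

¬¬-∀< : {P : ℕ → Set} → ∀ n → (∀ x → x < n → ¬ ¬ P x) → ¬ ¬ (∀ x → x < n → P x)
¬¬-∀< zero _ = pure λ _ ()
¬¬-∀< {P} (suc n) ¬¬P = extend <$> ¬¬-∀< n (λ x x<n → ¬¬P x (m<n⇒m<1+n x<n)) ⊛ ¬¬P n (n<1+n n)
  where
  extend : (∀ x → x < n → P x) → P n → ∀ x → x < suc n → P x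
  extend below Pn x x<1+n with m<1+n⇒m<n∨m≡n x<1+n
  ... | inj₁ x<n = below x x<n
  ... | inj₂ refl = Pn

module UltrafilterProperties {X : Set} {U : Family X} (isUltrafilter : IsUltrafilter U) where
  open IsUltrafilter isUltrafilter

  ∁-∉ : ∀ {A} → U A → ¬ U (∁ A)
  ∁-∉ uA u∁A = proper (upward (meet uA u∁A) λ _ (a , ¬a) → ¬a a)

  upward-¬¬ : ∀ {A B} → U A → A ⊆ (λ x → ¬ ¬ B x) → U B
  upward-¬¬ {B = B} uA A⊆¬¬B with ultra B
  ... | inj₁ uB = uB
  ... | inj₂ u∁B = ⊥-elim (proper (upward (meet uA u∁B) λ x (a , ¬b) → A⊆¬¬B x a ¬b))

  conditional∈ : ∀ A → U (λ x → U A → A x)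
  conditional∈ A with ultra A
  ... | inj₁ uA = upward uA λ _ a _ → a
  ... | inj₂ u∁A = upward whole λ _ _ uA → ⊥-elim (∁-∉ uA u∁A)

module NonprincipalProperties {U : Family ℕ} (isNonprincipal : IsNonprincipalUltrafilter U) where
  open IsNonprincipalUltrafilter isNonprincipal
  open IsUltrafilter isUltrafilter
  open UltrafilterProperties isUltrafilter

  ≢∈ : ∀ k → U (λ y → ¬ y ≡ k)
  ≢∈ k with ultra (λ y → y ≡ k)
  ... | inj₁ ≡k∈U = contradiction ≡k∈U (nonprincipal k)
  ... | inj₂ ≢k∈U = ≢k∈U

  ∉-list∈ : ∀ l → U (λ y → ¬ y ∈ l)
  ∉-list∈ [] = upward whole λ _ _ ()
  ∉-list∈ (k ∷ l) = upward (meet (≢∈ k) (∉-list∈ l)) λ where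
    _ (y≢k , _) (here y≡k) → y≢k y≡k
    _ (_ , y∉l) (there y∈l) → y∉l y∈l

module PPointProperties {U : Family ℕ} (isPPoint : IsPPoint U) where
  open IsPPoint isPPoint
  open IsNonprincipalUltrafilter nonprincipalUltrafilter
  open IsUltrafilter isUltrafilter
  open UltrafilterProperties isUltrafilter
  open NonprincipalProperties nonprincipalUltrafilter

  offGraph : UProdFin U → Elem (U · U)
  offGraph ((B , B∈U) , h) = (λ (x , y) → B x × B y × ¬ y ∈ h x) ,
    upward B∈U λ x Bx → upward (meet B∈U (∉-list∈ (h x))) λ _ (By , y∉hx) → Bx , By , y∉hx

  module Dominator (A : Subset (ℕ × ℕ)) (A∈U·U : (U · U) A) where
    fibre : ℕ → Subset ℕ
    fibre x y = A (x , y)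

    -- A_x if A_x ∈ U and ω otherwise, without having to decide which.
    conditionalFibre : ℕ → Subset ℕ
    conditionalFibre x y = U (fibre x) → fibre x y

    private
      pseudo : Σ (Subset ℕ) λ C → U C × (∀ x → Finite (C ∖ conditionalFibre x))
      pseudo = pseudoIntersection conditionalFibre (λ x → conditional∈ (fibre x))

    C : Subset ℕ
    C = proj₁ pseudo

    C∈U : U C
    C∈U = proj₁ (proj₂ pseudo)

    threshold : ℕ → ℕ
    threshold x = proj₁ (proj₂ (proj₂ pseudo) x)

    C⊆¬¬conditionalFibre : ∀ x y → C y → threshold x ≤ y → ¬ ¬ conditionalFibre x y
    C⊆¬¬conditionalFibre x y Cy N≤y ¬cond = <⇒≱ (proj₂ (proj₂ (proj₂ pseudo) x) y (Cy , ¬cond)) N≤y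

    diagonal : Subset ℕ
    diagonal y = ∀ x → x < y → threshold x ≤ y → conditionalFibre x y

    C⊆¬¬diagonal : C ⊆ (λ y → ¬ ¬ diagonal y)
    C⊆¬¬diagonal y Cy = ¬¬-∀< y λ x _ → conditionalAbove x
      where
      conditionalAbove : ∀ x → ¬ ¬ (threshold x ≤ y → conditionalFibre x y)
      conditionalAbove x with threshold x ≤? y
      ... | yes N≤y = ¬¬-map (λ cond _ → cond) (C⊆¬¬conditionalFibre x y Cy N≤y)
      ... | no N≰y = pure λ N≤y → contradiction N≤y N≰y

    bound : ℕ → ℕ
    bound x = suc x ⊔ threshold x

    dominator : UProdFin U
    dominator = ((λ x → U (fibre x) × diagonal x) , meet A∈U·U (upward-¬¬ C∈U C⊆¬¬diagonal)) ,
                λ x → upTo (bound x)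

    offGraph-dominated : ∀ q → _≤UPF_ {U = U} dominator q → proj₁ (offGraph q) ⊆ A
    offGraph-dominated ((B , _) , h) (B⊆ , upTo⊆h) (x , y) (Bx , By , y∉hx) =
      proj₂ (B⊆ y By) x (m⊔n≤o⇒m≤o (suc x) (threshold x) bound≤y)
                        (m⊔n≤o⇒n≤o (suc x) (threshold x) bound≤y)
                        (proj₁ (B⊆ x Bx))
      where
      bound≤y : bound x ≤ y
      bound≤y = ≮⇒≥ λ y<bound → y∉hx (upTo⊆h x (∈-upTo⁺ y<bound))

  offGraph-convergent : Convergent (_≤U_ {U = U · U}) (_≤UPF_ {U = U}) offGraph
  offGraph-convergent (A , A∈U·U) = dominator , offGraph-dominated
    where open Dominator A A∈U·U

corollary1p14 : (U : Family ℕ) → IsPPoint U →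
    TukeyLE (Elem (U · U)) (_≤U_ {U = U · U}) (UProdFin U) (_≤UPF_ {U = U})
corollary1p14 U isPPoint = convergent⇒tukey offGraph offGraph-convergent
  where open PPointProperties isPPoint
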